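{- Suppose $C_1+\cdots+C_n\geq d\cdot(w_1+\cdots+w_n)+b(\underline{w})$ and that $\mathcal{B}_\bullet$ is a $1$-feasible partition. If $$\sum_{i=2}^n g_i(\mathcal{B}_\bullet)\leq b(\underline{w}),$$ then $\mathcal{B}_\bullet$ is feasible.
   Context: Setting: integers $w_1\geq\cdots\geq w_n\geq0$, positive integer $d$, integers $C_1\geq\cdots\geq C_n$. $\mathcal{B}$ is the multiset with $d$ balls of weight $w_i$ for each $i$. A partition $\mathcal{B}_\bullet$ is $\mathcal{B}=\mathcal{B}_1\sqcup\cdots\sqcup\mathcal{B}_n$ with each $\mathcal{B}_i$ containing exactly $d$ balls; $w(\mathcal{B}_i)$ is its total weight, and the gaps are $g_i(\mathcal{B}_\bullet)=C_i-w(\mathcal{B}_i)$. The partition is feasible if all $g_i(\mathcal{B}_\bullet)\geq0$, and $1$-feasible if $g_i(\mathcal{B}_\bullet)\geq 0$ for $i=2,\dots,n$. $b(\underline{w})$: let $\lambda=(w_1,\dots,w_n)$, $r=n$, conjugate $\lambda'_j=\#\{i:w_i\geq j\}$ for $1\le j\le w_1$; write $\lambda'=(r^{a_0},h_1^{a_1},\dots,h_k^{a_k})$ ($c^a$ = $a$ entries equal to $c$), $a_0\geq0$, $a_t>0$, $r>h_1>\cdots>h_k>0$. If $k=0$, $b(\underline{w})=0$; otherwise with $h_0=r$, $b(\underline{w})=\sum_{t=1}^k(h_{t-1}-h_t)(a_t-1)+(h_k-1)(a_k-1)$. -}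

module Defs where

open import Data.Nat as ℕ using (ℕ; zero; suc; _∸_; _≤?_; _≟_)
open import Data.Integer as ℤ using (ℤ; +_; _-_)
open import Data.Fin as F using (Fin; zero; suc; toℕ)
open import Data.List using (List; []; _∷_; map; length; filter; upTo)
open import Data.Vec.Functional using (toList)
open import Data.Product using (_×_; _,_)
open import Relation.Nullary using (yes; no)
open import Relation.Binary.PropositionalEquality using (_≡_)

-- Finite integer sums over Fin n (indices 0-based: Fin index k is the paper's index k+1).
Σℤ : (n : ℕ) → (Fin n → ℤ) → ℤ
Σℤ zero    f = + 0
Σℤ (suc n) f = f zero ℤ.+ Σℤ n (λ i → f (suc i))

Σℤ-from2 : (n : ℕ) → (Fin n → ℤ) → ℤ
Σℤ-from2 zero    f = + 0
Σℤ-from2 (suc n) f = Σℤ n (λ i → f (suc i))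

Σℕ : (n : ℕ) → (Fin n → ℕ) → ℕ
Σℕ zero    f = 0
Σℕ (suc n) f = f zero ℕ.+ Σℕ n (λ i → f (suc i))

DecreasingN : (n : ℕ) → (Fin n → ℕ) → Set
DecreasingN n w = ∀ (i j : Fin n) → i F.≤ j → w j ℕ.≤ w i

DecreasingZ : (n : ℕ) → (Fin n → ℤ) → Set
DecreasingZ n C = ∀ (i j : Fin n) → i F.≤ j → C j ℤ.≤ C i

-- Partitions of the multiset B (d balls of weight w_j for each j) into
-- n parts of d balls each, encoded by m i j = number of balls of the
-- j-th weight type placed into part i.

record Partition (n d : ℕ) : Set where
  field
    m       : Fin n → Fin n → ℕ
    rowSum  : ∀ i → Σℕ n (λ j → m i j) ≡ d
    colSum  : ∀ j → Σℕ n (λ i → m i j) ≡ d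

open Partition public

weight : {n d : ℕ} → (Fin n → ℕ) → Partition n d → Fin n → ℕ
weight {n} w P i = Σℕ n (λ j → m P i j ℕ.* w j)

gap : {n d : ℕ} → (Fin n → ℕ) → (Fin n → ℤ) → Partition n d → Fin n → ℤ
gap w C P i = C i - + (weight w P i)

Feasible : {n d : ℕ} → (Fin n → ℕ) → (Fin n → ℤ) → Partition n d → Set
Feasible {n} w C P = ∀ (i : Fin n) → + 0 ℤ.≤ gap w C P i

-- 1-feasible: g_i ≥ 0 for i = 2..n (0-based: all indices except zero)
OneFeasible : {n d : ℕ} → (Fin n → ℕ) → (Fin n → ℤ) → Partition n d → Set
OneFeasible {n} w C P = ∀ (i : Fin n) → 0 ℕ.< toℕ i → + 0 ℤ.≤ gap w C P i

count≥ : ℕ → List ℕ → ℕ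
count≥ j ws = length (filter (λ x → j ≤? x) ws)

conjugate : List ℕ → List ℕ
conjugate []        = []
conjugate (w₁ ∷ ws) = map (λ k → count≥ (suc k) (w₁ ∷ ws)) (upTo w₁)

runs : List ℕ → List (ℕ × ℕ)
runs []       = []
runs (x ∷ xs) with runs xs
... | []             = (x , 1) ∷ []
... | (y , a) ∷ rest with x ≟ y
...   | yes _ = (y , suc a) ∷ rest
...   | no  _ = (x , 1) ∷ (y , a) ∷ rest

dropTop : ℕ → List (ℕ × ℕ) → List (ℕ × ℕ)
dropTop r []              = []
dropTop r ((h , a) ∷ rest) with h ≟ r
... | yes _ = rest
... | no  _ = (h , a) ∷ rest

bsum : ℕ → List (ℕ × ℕ) → ℕ
bsum prev []                    = 0
bsum prev ((h , a) ∷ [])        = (prev ∸ h) ℕ.* (a ∸ 1) ℕ.+ (h ∸ 1) ℕ.* (a ∸ 1)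
bsum prev ((h , a) ∷ p ∷ rest)  = (prev ∸ h) ℕ.* (a ∸ 1) ℕ.+ bsum h (p ∷ rest)

bList : List ℕ → ℕ
bList ws = bsum (length ws) (dropTop (length ws) (runs (conjugate ws)))

b : (n : ℕ) → (Fin n → ℕ) → ℕ
b n w = bList (toList w)

-- The gaps of a partition add up to Σ Cᵢ − d Σ wⱼ, since each weight type
-- contributes its d balls exactly once; by hypothesis this total is at least
-- b(w). If the gaps g₂, …, gₙ add up to at most b(w), the remaining gap g₁
-- must therefore be non-negative, and the others are by 1-feasibility.
module Submission where

open import Defs
open import Data.Nat using (ℕ) renaming (_≥_ to _≥ℕ_)
open import Data.Integer using (ℤ; +_; _+_; _*_; _≤_; _≥_)
open import Data.Fin using (Fin)
open import Data.Integer using (_-_; -_)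
open import Data.Fin using (zero; suc)

import Data.Nat as ℕ
import Data.Nat.Properties as ℕ
import Data.Integer as ℤ
import Data.Integer.Properties as ℤ
open import Data.Integer.Solver using (module +-*-Solver)
open import Algebra.Properties.Semiring.Sum ℕ.+-*-semiring
  using (sum; sum-cong-≗; ∑-comm; *-distribˡ-sum; *-distribʳ-sum)
open import Algebra.Properties.AbelianGroup ℤ.+-0-abelianGroup
  using (//-rightDividesʳ; xyx⁻¹≈y)
open import Relation.Binary.PropositionalEquality
open ≡-Reasoning

Σℕ≡sum : ∀ n (f : Fin n → ℕ) → Σℕ n f ≡ sum f
Σℕ≡sum ℕ.zero    f = refl
Σℕ≡sum (ℕ.suc n) f = cong (f zero ℕ.+_) (Σℕ≡sum n (λ i → f (suc i)))

pos-Σℕ : ∀ n (f : Fin n → ℕ) → + Σℕ n f ≡ Σℤ n (λ i → + f i)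
pos-Σℕ ℕ.zero    f = refl
pos-Σℕ (ℕ.suc n) f = begin
  + (f zero ℕ.+ Σℕ n (λ i → f (suc i)))     ≡⟨ ℤ.pos-+ (f zero) _ ⟩
  + f zero + + Σℕ n (λ i → f (suc i))       ≡⟨ cong (_+_ (+ f zero)) (pos-Σℕ n (λ i → f (suc i))) ⟩
  + f zero + Σℤ n (λ i → + f (suc i))       ∎

Σℤ-distrib-- : ∀ n (f g : Fin n → ℤ) → Σℤ n (λ i → f i - g i) ≡ Σℤ n f - Σℤ n g
Σℤ-distrib-- ℕ.zero    f g = refl
Σℤ-distrib-- (ℕ.suc n) f g = begin
  (f zero - g zero) + Σℤ n (λ i → f (suc i) - g (suc i))
    ≡⟨ cong (_+_ (f zero - g zero)) (Σℤ-distrib-- n (λ i → f (suc i)) (λ i → g (suc i))) ⟩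
  (f zero - g zero) + (Σℤ n (λ i → f (suc i)) - Σℤ n (λ i → g (suc i)))
    ≡⟨ interchange (f zero) (g zero) _ _ ⟩
  (f zero + Σℤ n (λ i → f (suc i))) - (g zero + Σℤ n (λ i → g (suc i)))
    ∎
  where
  open +-*-Solver
  interchange : ∀ a b c d → (a - b) + (c - d) ≡ (a + c) - (b + d)
  interchange = solve 4 (λ a b c d → (a :- b) :+ (c :- d) := (a :+ c) :- (b :+ d)) refl

totalWeight : ∀ {n d} (w : Fin n → ℕ) (P : Partition n d) →
              Σℕ n (weight w P) ≡ d ℕ.* Σℕ n w
totalWeight {n} {d} w P = begin
  Σℕ n (weight w P)                          ≡⟨ Σℕ≡sum n (weight w P) ⟩
  sum (λ i → weight w P i)                   ≡⟨ sum-cong-≗ (λ i → Σℕ≡sum n (λ j → m P i j ℕ.* w j)) ⟩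
  sum (λ i → sum (λ j → m P i j ℕ.* w j))    ≡⟨ ∑-comm (λ i j → m P i j ℕ.* w j) ⟩
  sum (λ j → sum (λ i → m P i j ℕ.* w j))    ≡⟨ sum-cong-≗ (λ j → sym (*-distribʳ-sum (w j) (λ i → m P i j))) ⟩
  sum (λ j → sum (λ i → m P i j) ℕ.* w j)    ≡⟨ sum-cong-≗ (λ j → cong (ℕ._* w j) ballsOfType) ⟩
  sum (λ j → d ℕ.* w j)                      ≡⟨ sym (*-distribˡ-sum d w) ⟩
  d ℕ.* sum w                                ≡⟨ cong (d ℕ.*_) (sym (Σℕ≡sum n w)) ⟩
  d ℕ.* Σℕ n w                               ∎
  where
  ballsOfType : ∀ {j} → sum (λ i → m P i j) ≡ d
  ballsOfType {j} = trans (sym (Σℕ≡sum n (λ i → m P i j))) (colSum P j)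

totalGap : ∀ {n d} (w : Fin n → ℕ) (C : Fin n → ℤ) (P : Partition n d) →
           Σℤ n (gap w C P) ≡ Σℤ n C - + d * + Σℕ n w
totalGap {n} {d} w C P = begin
  Σℤ n (gap w C P)                      ≡⟨ Σℤ-distrib-- n C (λ i → + weight w P i) ⟩
  Σℤ n C - Σℤ n (λ i → + weight w P i)  ≡⟨ cong (_-_ (Σℤ n C)) (sym (pos-Σℕ n (weight w P))) ⟩
  Σℤ n C - + Σℕ n (weight w P)          ≡⟨ cong (λ x → Σℤ n C - + x) (totalWeight w P) ⟩
  Σℤ n C - + (d ℕ.* Σℕ n w)             ≡⟨ cong (_-_ (Σℤ n C)) (ℤ.pos-* d (Σℕ n w)) ⟩
  Σℤ n C - + d * + Σℕ n w               ∎

i+j≤k⇒j≤k-i : ∀ {i j k} → i + j ≤ k → j ≤ k - i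
i+j≤k⇒j≤k-i {i} {j} {k} i+j≤k = subst (_≤ k - i) (xyx⁻¹≈y i j) (ℤ.+-monoˡ-≤ (- i) i+j≤k)

i≤j+i⇒0≤j : ∀ {i j} → i ≤ j + i → + 0 ≤ j
i≤j+i⇒0≤j {i} {j} i≤j+i = subst (+ 0 ≤_) (//-rightDividesʳ i j) (ℤ.i≤j⇒0≤j-i i≤j+i)

lemma2p3 : (n d : ℕ) → d ≥ℕ 1 → (w : Fin n → ℕ) → (C : Fin n → ℤ)
    → DecreasingN n w → DecreasingZ n C
    → Σℤ n C ≥ + d * + (Σℕ n w) + + (b n w)
    → (P : Partition n d) → OneFeasible w C P
    → Σℤ-from2 n (gap w C P) ≤ + (b n w)
    → Feasible w C P
lemma2p3 (ℕ.suc k) _ _ w C _ _ bound P _ gapsFrom2≤b zero =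
  i≤j+i⇒0≤j (ℤ.≤-trans gapsFrom2≤b b≤totalGap)
  where
  b≤totalGap : + b (ℕ.suc k) w ≤ Σℤ (ℕ.suc k) (gap w C P)
  b≤totalGap = subst (+ b (ℕ.suc k) w ≤_) (sym (totalGap w C P)) (i+j≤k⇒j≤k-i bound)
lemma2p3 (ℕ.suc k) _ _ _ _ _ _ _ _ oneFeasible _ (suc i) = oneFeasible (suc i) (ℕ.s≤s ℕ.z≤n)
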